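{- There are randomized algorithms which, given the vertex set $V(G)$ of a graph $G$ (whose edges are unknown) and positive integers $t$ and $k$: (a) with access to a BIS oracle for $G$, make $\mathcal{O}(k^4\log k)$ BIS queries and solve Decision-Cut, and (b) with access to a BISE oracle for $G$, make $\mathcal{O}(k^4\log k)$ BISE queries and solve Cut; each succeeds with probability at least $1-1/k^{c}$ for some constant $c>0$. Here Cut asks to output a partition $V_1\uplus\dots\uplus V_t$ of $V(G)$ such that at least $k$ edges have endpoints in different parts if such a partition exists, and otherwise to report that none exists; Decision-Cut asks to decide whether such a partition exists.
   Context: The BIS oracle takes two disjoint non-empty subsets $A,B\subseteq V(G)$ and answers whether some edge of $G$ has one endpoint in $A$ and the other in $B$. The BISE oracle takes the same input and returns such an edge (an arbitrary one) if one exists, and NULL otherwise. Only oracle queries are counted. -}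

module Defs where

open import Data.Nat using (ℕ; zero; suc; _+_; _*_; _^_; _≤_; _<ᵇ_)
open import Data.Nat.Logarithm using (⌊log₂_⌋)
open import Data.Bool using (Bool; true; false; _∧_; not)
open import Data.Fin using (Fin; toℕ; _≟_)
open import Data.Fin.Base using ()
open import Data.List using (List; length; filter; concatMap; map; allFin)
open import Data.List.Membership.Propositional using (_∉_)
open import Data.Maybe using (Maybe; just; nothing)
open import Data.Product using (Σ; ∃; ∃-syntax; _×_; _,_)
open import Data.Vec using (Vec)
open import Relation.Nullary using (¬_; does)
open import Relation.Binary.PropositionalEquality using (_≡_)
open import Data.Bool.Properties using (T?)

record Graph (n : ℕ) : Set where
  field
    adj   : Fin n → Fin n → Bool
    sym   : ∀ u v → adj u v ≡ adj v u
    irrefl : ∀ u → adj u u ≡ false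
open Graph public

VSet : ℕ → Set
VSet n = Fin n → Bool

record Query (n : ℕ) : Set where
  constructor mkQuery
  field
    setA     : VSet n
    setB     : VSet n
    disjoint : ∀ i → ¬ (setA i ≡ true × setB i ≡ true)
    nonemptyA : ∃[ i ] setA i ≡ true
    nonemptyB : ∃[ i ] setB i ≡ true
open Query public

CrossEdge : ∀ {n} → Graph n → Query n → Fin n → Fin n → Set
CrossEdge G q u v = setA q u ≡ true × setB q v ≡ true × adj G u v ≡ true

HasCrossEdge : ∀ {n} → Graph n → Query n → Set
HasCrossEdge G q = ∃[ u ] ∃[ v ] CrossEdge G q u v

IsBIS : ∀ {n} → Graph n → (Query n → Bool) → Set
IsBIS G O = ∀ q → (O q ≡ true → HasCrossEdge G q) × (HasCrossEdge G q → O q ≡ true)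

IsBISE : ∀ {n} → Graph n → (Query n → Maybe (Fin n × Fin n)) → Set
IsBISE G O = ∀ q → (∀ u v → O q ≡ just (u , v) → CrossEdge G q u v)
                 × (O q ≡ nothing → ¬ HasCrossEdge G q)

-- Deterministic query algorithms (decision trees); only queries are counted

data DTree (Q R A : Set) : Set where
  leaf  : A → DTree Q R A
  query : Q → (R → DTree Q R A) → DTree Q R A

run : ∀ {Q R A} → (Q → R) → DTree Q R A → A
run O (leaf a)    = a
run O (query q k) = run O (k (O q))

cost : ∀ {Q R A} → (Q → R) → DTree Q R A → ℕ
cost O (leaf a)    = 0
cost O (query q k) = suc (cost O (k (O q)))

-- Randomized query algorithm: a uniformly random seed of seedLen bits,
-- then a deterministic query algorithm depending on the seed.
record RandAlg (Q R A : Set) : Set where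
  field
    seedLen : ℕ
    tree    : Vec Bool seedLen → DTree Q R A
open RandAlg public

-- "Pr[Good] ≥ 1 - 1/k^(a/b)" over uniform seeds of length r:
-- all seeds outside a list L are good, and |L| / 2^r ≤ k^(-a/b),
-- i.e. |L|^b * k^a ≤ 2^(r*b).
SuccessAtLeast : (a b k r : ℕ) → (Vec Bool r → Set) → Set
SuccessAtLeast a b k r Good =
  ∃[ L ] ((∀ s → s ∉ L → Good s) × (length L ^ b * k ^ a ≤ 2 ^ (r * b)))

-- a partition V1 ⊎ … ⊎ Vt of V(G) (parts possibly empty)
Partition : ℕ → ℕ → Set
Partition n t = Fin n → Fin t

allPairs : (n : ℕ) → List (Fin n × Fin n)
allPairs n = concatMap (λ u → map (λ v → (u , v)) (allFin n)) (allFin n)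

cutSize : ∀ {n t} → Graph n → Partition n t → ℕ
cutSize {n} G f = length (filter (λ p → T? (crossing p)) (allPairs n))
  where
  crossing : Fin n × Fin n → Bool
  crossing (u , v) = (toℕ u <ᵇ toℕ v) ∧ adj G u v ∧ not (does (f u ≟ f v))

CutExists : ∀ {n} → Graph n → ℕ → ℕ → Set
CutExists {n} G t k = ∃[ f ] (k ≤ cutSize {n} {t} G f)

DecisionCutCorrect : ∀ {n} → Graph n → ℕ → ℕ → Bool → Set
DecisionCutCorrect G t k b = (b ≡ true → CutExists G t k) × (CutExists G t k → b ≡ true)

CutCorrect : ∀ {n} → Graph n → (t : ℕ) → ℕ → Maybe (Partition n t) → Set
CutCorrect {n} G t k out =
  (∀ f → out ≡ just f → k ≤ cutSize {n} {t} G f) × (out ≡ nothing → ¬ CutExists G t k)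

-- query bound C * k^4 * log k (with log k replaced by 1 + ⌊log₂ k⌋ so k = 1 is sensible)
queryBound : ℕ → ℕ → ℕ
queryBound C k = C * k ^ 4 * suc ⌊log₂ k ⌋

module Submission where

-- One round of the algorithm hashes the n vertices to q = 2^d colours using n·d
-- fresh random bits, asks one query for every ordered pair of distinct non-empty
-- colour classes (q² queries), and so learns the "colour graph" on Fin q.  It then
-- searches all colourings Fin q → Fin t of the colour graph for a cut of size ≥ k
-- and, if one is found, pulls it back along the hash.  Such a cut always lifts to a
-- cut of G of at least the same size (lift-cut), so outputs are always correct.
-- Conversely, if G has a cut f of size ≥ k, fix k crossing edges of f; whenever the
-- hash is injective on their ≤ 2k endpoints, f induces a cut of size ≥ k of the
-- colour graph (transfer-cut), so the round succeeds.  A union bound over the (2k)²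
-- endpoint pairs bounds the failure probability of one round by (2k)²/2^d ≤ 1/2
-- for d = 5 + 2⌊log₂ k⌋, and 1 + ⌊log₂ k⌋ independent rounds fail with probability
-- ≤ 1/k, using (1 + ⌊log₂ k⌋)·q² ≤ 1024 k⁴ (1 + ⌊log₂ k⌋) queries.

open import Defs hiding (sym)
open import Data.Bool using (Bool; true; false; _∧_; _∨_; not; if_then_else_; T)
open import Data.Bool.Properties using (T?; T-≡; ∧-comm; ∧-assoc; ∧-identityʳ)
open import Data.Empty using (⊥-elim)
open import Data.Fin using (Fin; zero; suc; combine; _≟_; toℕ)
open import Data.Fin.Properties using (any?; combine-injective; injective⇒≤; toℕ-injective)
open import Data.List using (List; []; _∷_; length; map; _++_; filter; take; concatMap; allFin; cartesianProduct; lookup; findᵇ)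
open import Data.List.Properties using (length-++; length-map; length-take; length-tabulate; map-∘; filter-≐)
open import Data.List.Membership.Propositional using (_∈_; _∉_)
open import Data.List.Membership.Propositional.Properties using (∈-map⁺; ∈-++⁺ˡ; ∈-++⁺ʳ; ∈-concatMap⁺; ∈-lookup; ∈-cartesianProduct⁺; ∈-allFin; ∈-filter⁺; ∈-filter⁻)
import Data.List.Relation.Binary.Sublist.Propositional as Sublist
open import Data.List.Relation.Binary.Sublist.Propositional.Properties using (take-⊆)
import Data.List.Relation.Unary.All as All
open import Data.List.Relation.Unary.AllPairs using (_∷_)
open import Data.List.Relation.Unary.Any using (here; there; index)
import Data.List.Relation.Unary.Any as Any
open import Data.List.Relation.Unary.Any.Properties using (lookup-index)
open import Data.List.Relation.Unary.Unique.Propositional using (Unique)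
open import Data.List.Relation.Unary.Unique.Propositional.Properties using (cartesianProduct⁺; allFin⁺; filter⁺; take⁺)
open import Data.Maybe using (Maybe; just; nothing; is-just)
import Data.Maybe as Maybe
open import Data.Nat using (ℕ; zero; suc; _+_; _*_; _^_; _∸_; _≤_; _<_; _≤ᵇ_; _<ᵇ_; z≤n; s≤s; ⌊_/2⌋; ⌈_/2⌉)
open import Data.Nat.Induction using (<-rec)
open import Data.Nat.Logarithm using (⌊log₂_⌋; ⌊log₂⌋-mono-≤; ⌊log₂[2^n]⌋≡n; ⌊log₂⌊n/2⌋⌋≡⌊log₂n⌋∸1)
open import Data.Nat.Properties hiding (_≟_)
open import Data.Nat.Tactic.RingSolver using (solve-∀)
open import Data.Product using (∃-syntax; Σ-syntax; _×_; _,_; proj₁; proj₂)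
import Data.Product.Properties as Product
open import Data.Sum using (_⊎_; inj₁; inj₂)
open import Data.Unit using (tt)
open import Data.Vec using (Vec; []; _∷_)
import Data.Vec as Vec
open import Function.Bundles using (Equivalence)
open import Relation.Binary.Definitions using (DecidableEquality)
open import Relation.Binary.PropositionalEquality
open import Relation.Nullary using (¬_; does; yes; no; Dec)
open import Relation.Nullary.Decidable using (dec-true)
open import Algebra.Properties.CommutativeSemigroup +-commutativeSemigroup using () renaming (interchange to +-interchange)
open import Algebra.Properties.CommutativeSemigroup *-commutativeSemigroup using () renaming (interchange to *-interchange)

-- Random seeds are uniform bit strings; probabilities are ratios of counts.

indicator : Bool → ℕ
indicator true  = 1
indicator false = 0

count : (r : ℕ) → (Vec Bool r → Bool) → ℕ
count zero    P = indicator (P [])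
count (suc r) P = count r (λ s → P (true ∷ s)) + count r (λ s → P (false ∷ s))

seedsWith : (r : ℕ) → (Vec Bool r → Bool) → List (Vec Bool r)
seedsWith zero    P = if P [] then [] ∷ [] else []
seedsWith (suc r) P = map (true ∷_) (seedsWith r (λ s → P (true ∷ s)))
                   ++ map (false ∷_) (seedsWith r (λ s → P (false ∷ s)))

length-seedsWith : ∀ r P → length (seedsWith r P) ≡ count r P
length-seedsWith zero P with P []
... | true  = refl
... | false = refl
length-seedsWith (suc r) P = begin
  length (map (true ∷_) ts ++ map (false ∷_) fs)      ≡⟨ length-++ (map (true ∷_) ts) ⟩
  length (map (true ∷_) ts) + length (map (false ∷_) fs)
    ≡⟨ cong₂ _+_ (length-map _ ts) (length-map _ fs) ⟩
  length ts + length fs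
    ≡⟨ cong₂ _+_ (length-seedsWith r _) (length-seedsWith r _) ⟩
  count (suc r) P                                      ∎
  where
  open ≡-Reasoning
  ts fs : List (Vec Bool r)
  ts = seedsWith r (λ s → P (true ∷ s))
  fs = seedsWith r (λ s → P (false ∷ s))

∈-seedsWith : ∀ r P s → P s ≡ true → s ∈ seedsWith r P
∈-seedsWith zero    P []          Ps rewrite Ps = here refl
∈-seedsWith (suc r) P (true ∷ s)  Ps = ∈-++⁺ˡ (∈-map⁺ (true ∷_) (∈-seedsWith r _ s Ps))
∈-seedsWith (suc r) P (false ∷ s) Ps =
  ∈-++⁺ʳ (map (true ∷_) (seedsWith r _)) (∈-map⁺ (false ∷_) (∈-seedsWith r _ s Ps))

count-cong : ∀ r P Q → (∀ s → P s ≡ Q s) → count r P ≡ count r Q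
count-cong zero    P Q P≗Q = cong indicator (P≗Q [])
count-cong (suc r) P Q P≗Q =
  cong₂ _+_ (count-cong r _ _ (λ s → P≗Q (true ∷ s))) (count-cong r _ _ (λ s → P≗Q (false ∷ s)))

count-true : ∀ r → count r (λ _ → true) ≡ 2 ^ r
count-true zero    = refl
count-true (suc r) = trans (cong₂ _+_ (count-true r) (count-true r)) (cong (2 ^ r +_) (sym (+-identityʳ (2 ^ r))))

count-false : ∀ r → count r (λ _ → false) ≡ 0
count-false zero    = refl
count-false (suc r) = cong₂ _+_ (count-false r) (count-false r)

count-∨ : ∀ r P Q → count r (λ s → P s ∨ Q s) ≤ count r P + count r Q
count-∨ zero P Q with P []
... | true  = s≤s z≤n
... | false = ≤-refl
count-∨ (suc r) P Q = ≤-trans (+-mono-≤ (count-∨ r _ _) (count-∨ r _ _))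
  (≤-reflexive (+-interchange (count r _) (count r _) (count r _) (count r _)))

count-split : ∀ r (c W : Vec Bool r → Bool) →
  count r (λ s → c s ∧ W s) + count r (λ s → not (c s) ∧ W s) ≡ count r W
count-split zero c W with c []
... | true  = +-identityʳ _
... | false = refl
count-split (suc r) c W = begin
  (a + b) + (a' + b') ≡⟨ +-interchange a b a' b' ⟩
  (a + a') + (b + b') ≡⟨ cong₂ _+_ (count-split r _ _) (count-split r _ _) ⟩
  count (suc r) W     ∎
  where
  open ≡-Reasoning
  a b a' b' : ℕ
  a  = count r (λ s → c (true ∷ s) ∧ W (true ∷ s))
  b  = count r (λ s → c (false ∷ s) ∧ W (false ∷ s))
  a' = count r (λ s → not (c (true ∷ s)) ∧ W (true ∷ s))
  b' = count r (λ s → not (c (false ∷ s)) ∧ W (false ∷ s))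

count-independent : ∀ m r P Q →
  count (m + r) (λ s → P (Vec.take m s) ∧ Q (Vec.drop m s)) ≡ count m P * count r Q
count-independent zero r P Q with P []
... | true  = sym (+-identityʳ _)
... | false = count-false r
count-independent (suc m) r P Q =
  trans (cong₂ _+_ (count-independent m r _ Q) (count-independent m r _ Q))
        (sym (*-distribʳ-+ (count r Q) (count m _) (count m _)))

sameBit : Bool → Bool → Bool
sameBit true  b = b
sameBit false b = not b

sameBits : ∀ {d} → Vec Bool d → Vec Bool d → Bool
sameBits []      []      = true
sameBits (a ∷ u) (b ∷ v) = sameBit a b ∧ sameBits u v

sameBits-sym : ∀ {d} (u v : Vec Bool d) → sameBits u v ≡ sameBits v u
sameBits-sym []          []      = refl
sameBits-sym (true ∷ u)  (b ∷ v) = cong₂ _∧_ (lemma b) (sameBits-sym u v)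
  where lemma : ∀ b → b ≡ sameBit b true
        lemma true = refl ; lemma false = refl
sameBits-sym (false ∷ u) (b ∷ v) = cong₂ _∧_ (lemma b) (sameBits-sym u v)
  where lemma : ∀ b → not b ≡ sameBit b false
        lemma true = refl ; lemma false = refl

sameBits-≡ : ∀ {d} (u v : Vec Bool d) → u ≡ v → sameBits u v ≡ true
sameBits-≡ []          []          refl = refl
sameBits-≡ (true ∷ u)  (true ∷ u)  refl = sameBits-≡ u u refl
sameBits-≡ (false ∷ u) (false ∷ u) refl = sameBits-≡ u u refl

count-agree : ∀ d r (F : Vec Bool r → Vec Bool d) (W : Vec Bool r → Bool) →
  count (d + r) (λ s → sameBits (Vec.take d s) (F (Vec.drop d s)) ∧ W (Vec.drop d s)) ≡ count r W
count-agree zero    r F W = count-cong r _ W (λ w → no-bits (F w) (W w))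
  where no-bits : (v : Vec Bool 0) (b : Bool) → sameBits [] v ∧ b ≡ b
        no-bits [] b = refl
count-agree (suc d) r F W = begin
  count (d + r) (λ s → sameBits (true ∷ Vec.take d s) (F (Vec.drop d s)) ∧ W (Vec.drop d s))
    + count (d + r) (λ s → sameBits (false ∷ Vec.take d s) (F (Vec.drop d s)) ∧ W (Vec.drop d s))
    ≡⟨ cong₂ _+_ (count-cong (d + r) _ _ (λ s → first-bit true (Vec.take d s) (F (Vec.drop d s)) (W (Vec.drop d s))))
                 (count-cong (d + r) _ _ (λ s → first-bit false (Vec.take d s) (F (Vec.drop d s)) (W (Vec.drop d s)))) ⟩
  count (d + r) (λ s → sameBits (Vec.take d s) (F′ (Vec.drop d s)) ∧ (c (Vec.drop d s) ∧ W (Vec.drop d s)))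
    + count (d + r) (λ s → sameBits (Vec.take d s) (F′ (Vec.drop d s)) ∧ (not (c (Vec.drop d s)) ∧ W (Vec.drop d s)))
    ≡⟨ cong₂ _+_ (count-agree d r F′ (λ w → c w ∧ W w)) (count-agree d r F′ (λ w → not (c w) ∧ W w)) ⟩
  count r (λ w → c w ∧ W w) + count r (λ w → not (c w) ∧ W w)
    ≡⟨ count-split r c W ⟩
  count r W ∎
  where
  open ≡-Reasoning
  c : Vec Bool r → Bool
  c w = Vec.head (F w)
  F′ : Vec Bool r → Vec Bool d
  F′ w = Vec.tail (F w)
  first-bit : ∀ a u (v : Vec Bool (suc d)) w →
    sameBits (a ∷ u) v ∧ w ≡ sameBits u (Vec.tail v) ∧ (sameBit a (Vec.head v) ∧ w)
  first-bit a u (b ∷ v) w = trans (cong (_∧ w) (∧-comm (sameBit a b) (sameBits u v)))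
                                  (∧-assoc (sameBits u v) (sameBit a b) w)

count-agree-any : ∀ d r (F : Vec Bool r → Vec Bool d) →
  count (d + r) (λ s → sameBits (Vec.take d s) (F (Vec.drop d s))) ≡ 2 ^ r
count-agree-any d r F = begin
  count (d + r) (λ s → sameBits (Vec.take d s) (F (Vec.drop d s)))
    ≡⟨ count-cong (d + r) _ _ (λ s → sym (∧-identityʳ _)) ⟩
  count (d + r) (λ s → sameBits (Vec.take d s) (F (Vec.drop d s)) ∧ true)
    ≡⟨ count-agree d r F (λ _ → true) ⟩
  count r (λ _ → true) ≡⟨ count-true r ⟩
  2 ^ r ∎
  where open ≡-Reasoning

-- A seed of n·d bits read as n blocks of d bits: a random d-bit label per vertex.
block : ∀ n d → Vec Bool (n * d) → Fin n → Vec Bool d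
block (suc n) d s zero    = Vec.take d s
block (suc n) d s (suc x) = block n d (Vec.drop d s) x

-- When vertex 0 is involved, its block is fresh relative to the other one.
fresh-block : ∀ {c} d r → c ≡ 2 ^ r → c * 2 ^ d ≡ 2 ^ (d + r)
fresh-block {c} d r refl = trans (*-comm c (2 ^ d)) (sym (^-distribˡ-+-* 2 d r))

collision : ∀ n d (x y : Fin n) → ¬ x ≡ y →
  count (n * d) (λ s → sameBits (block n d s x) (block n d s y)) * 2 ^ d ≡ 2 ^ (n * d)
collision (suc n) d zero    zero    x≢y = ⊥-elim (x≢y refl)
collision (suc n) d zero    (suc y) x≢y =
  fresh-block d (n * d) (count-agree-any d (n * d) (λ s → block n d s y))
collision (suc n) d (suc x) zero    x≢y = fresh-block d (n * d) (trans
  (count-cong (d + n * d) _ _ (λ s → sameBits-sym (block n d (Vec.drop d s) x) (Vec.take d s)))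
  (count-agree-any d (n * d) (λ s → block n d s x)))
collision (suc n) d (suc x) (suc y) x≢y = begin
  count (d + n * d) (λ s → true ∧ E (Vec.drop d s)) * 2 ^ d
    ≡⟨ cong (_* 2 ^ d) (count-independent d (n * d) (λ _ → true) E) ⟩
  (count d (λ _ → true) * count (n * d) E) * 2 ^ d
    ≡⟨ *-assoc (count d (λ _ → true)) _ _ ⟩
  count d (λ _ → true) * (count (n * d) E * 2 ^ d)
    ≡⟨ cong₂ _*_ (count-true d) (collision n d x y (λ x≡y → x≢y (cong suc x≡y))) ⟩
  2 ^ d * 2 ^ (n * d) ≡⟨ sym (^-distribˡ-+-* 2 d (n * d)) ⟩
  2 ^ (d + n * d) ∎
  where
  open ≡-Reasoning
  E : Vec Bool (n * d) → Bool
  E s = sameBits (block n d s x) (block n d s y)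

bitColour : Bool → Fin 2
bitColour true  = zero
bitColour false = suc zero

colour : ∀ {d} → Vec Bool d → Fin (2 ^ d)
colour []      = zero
colour (b ∷ v) = combine (bitColour b) (colour v)

colour-injective : ∀ {d} (u v : Vec Bool d) → colour u ≡ colour v → u ≡ v
colour-injective []      []      _  = refl
colour-injective (a ∷ u) (b ∷ v) eq
  with combine-injective (bitColour a) (colour u) (bitColour b) (colour v) eq
... | a≡b , u≡v = cong₂ _∷_ (bit a b a≡b) (colour-injective u v u≡v)
  where bit : ∀ a b → bitColour a ≡ bitColour b → a ≡ b
        bit true true _ = refl ; bit false false _ = refl

merges : ∀ n d → List (Fin n × Fin n) → Vec Bool (n * d) → Bool
merges n d []             s = false
merges n d ((x , y) ∷ ps) s =
  (not (does (x ≟ y)) ∧ sameBits (block n d s x) (block n d s y)) ∨ merges n d ps s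

merges-bound : ∀ n d ps → count (n * d) (merges n d ps) * 2 ^ d ≤ length ps * 2 ^ (n * d)
merges-bound n d [] = ≤-reflexive (cong (_* 2 ^ d) (count-false (n * d)))
merges-bound n d ((x , y) ∷ ps) = begin
  count (n * d) (λ s → M s ∨ merges n d ps s) * 2 ^ d
    ≤⟨ *-monoˡ-≤ (2 ^ d) (count-∨ (n * d) M (merges n d ps)) ⟩
  (count (n * d) M + count (n * d) (merges n d ps)) * 2 ^ d
    ≡⟨ *-distribʳ-+ (2 ^ d) (count (n * d) M) _ ⟩
  count (n * d) M * 2 ^ d + count (n * d) (merges n d ps) * 2 ^ d
    ≤⟨ +-mono-≤ pair-bound (merges-bound n d ps) ⟩
  2 ^ (n * d) + length ps * 2 ^ (n * d) ∎
  where
  open ≤-Reasoning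
  M : Vec Bool (n * d) → Bool
  M s = not (does (x ≟ y)) ∧ sameBits (block n d s x) (block n d s y)
  pair-bound : count (n * d) M * 2 ^ d ≤ 2 ^ (n * d)
  pair-bound with x ≟ y
  ... | yes _   = ≤-trans (≤-reflexive (cong (_* 2 ^ d) (count-false (n * d)))) z≤n
  ... | no  x≢y = ≤-reflexive (collision n d x y x≢y)

unmerged : ∀ n d ps s x y → merges n d ps s ≡ false → (x , y) ∈ ps →
  block n d s x ≡ block n d s y → x ≡ y
unmerged n d ((x , y) ∷ ps) s x y noMerge (here refl) same with x ≟ y
... | yes x≡y = x≡y
... | no  _   with sameBits (block n d s x) (block n d s y) | sameBits-≡ _ _ same
unmerged n d ((x , y) ∷ ps) s x y () (here refl) same | no _ | true | refl
unmerged n d ((a , b) ∷ ps) s x y noMerge (there p) same =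
  unmerged n d ps s x y (∨-false-right noMerge) p same
  where ∨-false-right : ∀ {a b} → a ∨ b ≡ false → b ≡ false
        ∨-false-right {false} eq = eq

allRoundsFail : ∀ R m → (Vec Bool m → Bool) → Vec Bool (R * m) → Bool
allRoundsFail zero    m B s = true
allRoundsFail (suc R) m B s = B (Vec.take m s) ∧ allRoundsFail R m B (Vec.drop m s)

count-allRoundsFail : ∀ R m B → count (R * m) (allRoundsFail R m B) ≡ count m B ^ R
count-allRoundsFail zero    m B = refl
count-allRoundsFail (suc R) m B =
  trans (count-independent m (R * m) B (allRoundsFail R m B)) (cong (count m B *_) (count-allRoundsFail R m B))

amplify : ∀ R m c → 2 * c ≤ 2 ^ m → 2 ^ R * c ^ R ≤ 2 ^ (R * m)
amplify zero    m c half = ≤-refl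
amplify (suc R) m c half = begin
  (2 * 2 ^ R) * (c * c ^ R) ≡⟨ *-interchange 2 (2 ^ R) c (c ^ R) ⟩
  (2 * c) * (2 ^ R * c ^ R) ≤⟨ *-mono-≤ half (amplify R m c half) ⟩
  2 ^ m * 2 ^ (R * m)       ≡⟨ sym (^-distribˡ-+-* 2 m (R * m)) ⟩
  2 ^ (m + R * m)           ∎
  where open ≤-Reasoning

unique-lookup-injective : ∀ {X : Set} (xs : List X) → Unique xs →
  ∀ i j → lookup xs i ≡ lookup xs j → i ≡ j
unique-lookup-injective (x ∷ xs) u        zero    zero    eq = refl
unique-lookup-injective (x ∷ xs) (x∉ ∷ u) zero    (suc j) eq = ⊥-elim (All.lookup x∉ (∈-lookup j) eq)
unique-lookup-injective (x ∷ xs) (x∉ ∷ u) (suc i) zero    eq = ⊥-elim (All.lookup x∉ (∈-lookup i) (sym eq))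
unique-lookup-injective (x ∷ xs) (x∉ ∷ u) (suc i) (suc j) eq = cong suc (unique-lookup-injective xs u i j eq)

injection-length : {X Y : Set} (xs : List X) (ys : List Y) → Unique xs →
  (σ : ∀ {x} → x ∈ xs → Y) → (∀ {x} (p : x ∈ xs) → σ p ∈ ys) →
  (∀ {x x′} (p : x ∈ xs) (p′ : x′ ∈ xs) → σ p ≡ σ p′ → x ≡ x′) → length xs ≤ length ys
injection-length xs ys uniq σ σ∈ys σ-inj = injective⇒≤ {f = position} position-injective
  where
  position : Fin (length xs) → Fin (length ys)
  position i = index (σ∈ys (∈-lookup i))
  position-injective : ∀ {i j} → position i ≡ position j → i ≡ j
  position-injective {i} {j} eq = unique-lookup-injective xs uniq i j
    (σ-inj (∈-lookup i) (∈-lookup j) (begin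
      σ (∈-lookup i)            ≡⟨ lookup-index (σ∈ys (∈-lookup i)) ⟩
      lookup ys (position i)    ≡⟨ cong (lookup ys) eq ⟩
      lookup ys (position j)    ≡⟨ sym (lookup-index (σ∈ys (∈-lookup j))) ⟩
      σ (∈-lookup j)            ∎))
    where open ≡-Reasoning

allPairs-product : ∀ {A B : Set} (xs : List A) (ys : List B) →
  concatMap (λ u → map (λ v → (u , v)) ys) xs ≡ cartesianProduct xs ys
allPairs-product []       ys = refl
allPairs-product (x ∷ xs) ys = cong (map (λ v → (x , v)) ys ++_) (allPairs-product xs ys)

allPairs-unique : ∀ N → Unique (allPairs N)
allPairs-unique N = subst Unique (sym (allPairs-product (allFin N) (allFin N)))
  (cartesianProduct⁺ (allFin⁺ N) (allFin⁺ N))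

∈-allPairs : ∀ {N} (u v : Fin N) → (u , v) ∈ allPairs N
∈-allPairs {N} u v = subst ((u , v) ∈_) (sym (allPairs-product (allFin N) (allFin N)))
  (∈-cartesianProduct⁺ (∈-allFin u) (∈-allFin v))

length-cartesianProduct : ∀ {A B : Set} (xs : List A) (ys : List B) →
  length (cartesianProduct xs ys) ≡ length xs * length ys
length-cartesianProduct []       ys = refl
length-cartesianProduct (x ∷ xs) ys = begin
  length (map (x ,_) ys ++ cartesianProduct xs ys)        ≡⟨ length-++ (map (x ,_) ys) ⟩
  length (map (x ,_) ys) + length (cartesianProduct xs ys)
    ≡⟨ cong₂ _+_ (length-map (x ,_) ys) (length-cartesianProduct xs ys) ⟩
  length ys + length xs * length ys                      ∎
  where open ≡-Reasoning

length-allPairs : ∀ N → length (allPairs N) ≡ N * N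
length-allPairs N = begin
  length (allPairs N) ≡⟨ cong length (allPairs-product (allFin N) (allFin N)) ⟩
  length (cartesianProduct (allFin N) (allFin N)) ≡⟨ length-cartesianProduct (allFin N) (allFin N) ⟩
  length (allFin N) * length (allFin N) ≡⟨ cong₂ _*_ (length-tabulate {n = N} (λ x → x)) (length-tabulate {n = N} (λ x → x)) ⟩
  N * N ∎
  where open ≡-Reasoning

-- Crossing edges of a colouring F for an arbitrary Boolean relation A on Fin N;
-- cutSize G f is  crossCount (adj G) f.
crosses : ∀ {N t} → (Fin N → Fin N → Bool) → (Fin N → Fin t) → Fin N × Fin N → Bool
crosses A F (u , v) = (toℕ u <ᵇ toℕ v) ∧ A u v ∧ not (does (F u ≟ F v))

crossingPairs : ∀ {N t} → (Fin N → Fin N → Bool) → (Fin N → Fin t) → List (Fin N × Fin N)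
crossingPairs {N} A F = filter (λ p → T? (crosses A F p)) (allPairs N)

crossCount : ∀ {N t} → (Fin N → Fin N → Bool) → (Fin N → Fin t) → ℕ
crossCount A F = length (crossingPairs A F)

crossCount-cong : ∀ {N t} (A : Fin N → Fin N → Bool) (F F′ : Fin N → Fin t) →
  (∀ i → F i ≡ F′ i) → crossCount A F ≡ crossCount A F′
crossCount-cong {N} A F F′ F≗F′ = cong length (filter-≐ (λ p → T? (crosses A F p)) (λ p → T? (crosses A F′ p))
  ((λ {p} → subst T (same p)) , (λ {p} → subst T (sym (same p)))) (allPairs N))
  where
  same : ∀ p → crosses A F p ≡ crosses A F′ p
  same (u , v) rewrite F≗F′ u | F≗F′ v = refl

crossingPairs-unique : ∀ {N t} (A : Fin N → Fin N → Bool) (F : Fin N → Fin t) → Unique (crossingPairs A F)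
crossingPairs-unique {N} A F = filter⁺ _ (allPairs-unique N)

∈crossing⁻ : ∀ {N t} (A : Fin N → Fin N → Bool) (F : Fin N → Fin t) {u v} →
  (u , v) ∈ crossingPairs A F → toℕ u < toℕ v × A u v ≡ true × ¬ F u ≡ F v
∈crossing⁻ {N} A F {u} {v} p = elim (proj₂ (∈-filter⁻ (λ p → T? (crosses A F p)) {xs = allPairs N} p))
  where
  elim : T (crosses A F (u , v)) → toℕ u < toℕ v × A u v ≡ true × ¬ F u ≡ F v
  elim c with toℕ u <ᵇ toℕ v in u<v | A u v | F u ≟ F v
  ... | true  | true  | no F≢ = <ᵇ⇒< (toℕ u) (toℕ v) (subst T (sym u<v) tt) , refl , F≢
  ... | true  | true  | yes _ = ⊥-elim c
  ... | true  | false | _     = ⊥-elim c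
  ... | false | _     | _     = ⊥-elim c

∈crossing⁺ : ∀ {N t} (A : Fin N → Fin N → Bool) (F : Fin N → Fin t) {u v} →
  toℕ u < toℕ v → A u v ≡ true → ¬ F u ≡ F v → (u , v) ∈ crossingPairs A F
∈crossing⁺ A F {u} {v} u<v a F≢ = ∈-filter⁺ (λ p → T? (crosses A F p)) (∈-allPairs u v) (intro u<v)
  where
  intro : toℕ u < toℕ v → T (crosses A F (u , v))
  intro u<v rewrite a with toℕ u <ᵇ toℕ v | <⇒<ᵇ u<v | F u ≟ F v
  ... | true  | _  | no _   = tt
  ... | true  | _  | yes F≡ = F≢ F≡

-- An unordered pair {u, v} written as the ordered pair with the smaller index first.
order : ∀ {N} → Fin N → Fin N → Fin N × Fin N
order u v with toℕ u <? toℕ v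
... | yes _ = (u , v)
... | no  _ = (v , u)

order-∈crossing : ∀ {N t} (A : Fin N → Fin N → Bool) (F : Fin N → Fin t) {u v} →
  A u v ≡ true → A v u ≡ true → ¬ F u ≡ F v → order u v ∈ crossingPairs A F
order-∈crossing A F {u} {v} auv avu F≢ with toℕ u <? toℕ v
... | yes u<v = ∈crossing⁺ A F u<v auv F≢
... | no  u≮v = ∈crossing⁺ A F v<u avu (λ e → F≢ (sym e))
  where v<u : toℕ v < toℕ u
        v<u = ≤∧≢⇒< (≮⇒≥ u≮v) (λ e → F≢ (cong F (toℕ-injective (sym e))))

order-injective : ∀ {N} (u v u′ v′ : Fin N) → order u v ≡ order u′ v′ →
  (u ≡ u′ × v ≡ v′) ⊎ (u ≡ v′ × v ≡ u′)
order-injective u v u′ v′ eq with toℕ u <? toℕ v | toℕ u′ <? toℕ v′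
order-injective u v u′ v′ refl | yes _ | yes _ = inj₁ (refl , refl)
order-injective u v u′ v′ refl | yes _ | no  _ = inj₂ (refl , refl)
order-injective u v u′ v′ refl | no  _ | yes _ = inj₂ (refl , refl)
order-injective u v u′ v′ refl | no  _ | no  _ = inj₁ (refl , refl)

increasing-pairs-equal : ∀ {N} {i j i′ j′ : Fin N} → toℕ i < toℕ j → toℕ i′ < toℕ j′ →
  (i ≡ i′ × j ≡ j′) ⊎ (i ≡ j′ × j ≡ i′) → (i , j) ≡ (i′ , j′)
increasing-pairs-equal _   _     (inj₁ (refl , refl)) = refl
increasing-pairs-equal i<j i′<j′ (inj₂ (refl , refl)) = ⊥-elim (<-asym i<j i′<j′)

lift-cut : ∀ {n q t} (G : Graph n) (h : Fin n → Fin q) (Q : Fin q → Fin q → Bool) (g : Fin q → Fin t) →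
  (∀ i j → Q i j ≡ true → ∃[ u ] ∃[ v ] (h u ≡ i × h v ≡ j × adj G u v ≡ true)) →
  crossCount Q g ≤ crossCount (adj G) (λ v → g (h v))
lift-cut G h Q g witness = injection-length (crossingPairs Q g) _ (crossingPairs-unique Q g) σ σ∈ σ-inj
  where
  edge : ∀ {i j} → (i , j) ∈ crossingPairs Q g → ∃[ u ] ∃[ v ] (h u ≡ i × h v ≡ j × adj G u v ≡ true)
  edge {i} {j} p = witness i j (proj₁ (proj₂ (∈crossing⁻ Q g p)))
  σ : ∀ {x} → x ∈ crossingPairs Q g → Fin _ × Fin _
  σ p = let (u , v , _) = edge p in order u v
  σ∈ : ∀ {x} (p : x ∈ crossingPairs Q g) → σ p ∈ crossingPairs (adj G) (λ v → g (h v))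
  σ∈ p = let (u , v , hu , hv , e) = edge p ; (_ , _ , g≢) = ∈crossing⁻ Q g p in
    order-∈crossing (adj G) (λ v → g (h v)) e (trans (Graph.sym G _ _) e)
      (λ eq → g≢ (subst₂ (λ a b → g a ≡ g b) hu hv eq))
  classOf : ∀ {a b c d} → h a ≡ c → h b ≡ d → a ≡ b → c ≡ d
  classOf ha hb refl = trans (sym ha) hb
  σ-inj : ∀ {x x′} (p : x ∈ crossingPairs Q g) (p′ : x′ ∈ crossingPairs Q g) → σ p ≡ σ p′ → x ≡ x′
  σ-inj p p′ eq with edge p | edge p′ | order-injective _ _ _ _ eq
  ... | u , v , hu , hv , _ | u′ , v′ , hu′ , hv′ , _ | inj₁ (u≡u′ , v≡v′) =
    increasing-pairs-equal (proj₁ (∈crossing⁻ Q g p)) (proj₁ (∈crossing⁻ Q g p′))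
      (inj₁ (classOf hu hu′ u≡u′ , classOf hv hv′ v≡v′))
  ... | u , v , hu , hv , _ | u′ , v′ , hu′ , hv′ , _ | inj₂ (u≡v′ , v≡u′) =
    increasing-pairs-equal (proj₁ (∈crossing⁻ Q g p)) (proj₁ (∈crossing⁻ Q g p′))
      (inj₂ (classOf hu hv′ u≡v′ , classOf hv hu′ v≡u′))

endpoints : ∀ {n} → List (Fin n × Fin n) → List (Fin n)
endpoints []            = []
endpoints ((u , v) ∷ E) = u ∷ v ∷ endpoints E

length-endpoints : ∀ {n} (E : List (Fin n × Fin n)) → length (endpoints E) ≡ 2 * length E
length-endpoints []            = refl
length-endpoints ((u , v) ∷ E) = trans (cong (2 +_) (length-endpoints E)) (sym (*-suc 2 (length E)))

∈-endpoints : ∀ {n} (E : List (Fin n × Fin n)) {u v} → (u , v) ∈ E → u ∈ endpoints E × v ∈ endpoints E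
∈-endpoints ((u , v) ∷ E) (here refl) = here refl , there (here refl)
∈-endpoints ((a , b) ∷ E) (there p)   = let (u∈ , v∈) = ∈-endpoints E p in there (there u∈) , there (there v∈)

InjectiveOn : ∀ {A B : Set} → (A → B) → List A → Set
InjectiveOn h S = ∀ x y → x ∈ S → y ∈ S → h x ≡ h y → x ≡ y

classColouring : ∀ {n q t} → (Fin n → Fin q) → (Fin n → Fin t) → Fin t → List (Fin n) → Fin q → Fin t
classColouring h f d []      i = d
classColouring h f d (x ∷ S) i with h x ≟ i
... | yes _ = f x
... | no  _ = classColouring h f d S i

classColouring-agrees : ∀ {n q t} (h : Fin n → Fin q) (f : Fin n → Fin t) d S →
  InjectiveOn h S → ∀ x → x ∈ S → classColouring h f d S (h x) ≡ f x
classColouring-agrees h f d (y ∷ S) inj x x∈ with h y ≟ h x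
... | yes hy≡hx = cong f (inj y x (here refl) x∈ hy≡hx)
... | no  hy≢hx with x∈
...   | here refl = ⊥-elim (hy≢hx refl)
...   | there x∈S = classColouring-agrees h f d S (λ a b a∈ b∈ → inj a b (there a∈) (there b∈)) x x∈S

transfer-cut : ∀ {n q t} (G : Graph n) (h : Fin n → Fin q) (Q : Fin q → Fin q → Bool)
  (f : Partition n t) (d : Fin t) (E : List (Fin n × Fin n)) → Unique E →
  (∀ {e} → e ∈ E → e ∈ crossingPairs (adj G) f) → InjectiveOn h (endpoints E) →
  (∀ u v → adj G u v ≡ true → ¬ h u ≡ h v → Q (h u) (h v) ≡ true) →
  length E ≤ crossCount Q (classColouring h f d (endpoints E))
transfer-cut {n} {q} {t} G h Q f d E uniqE E⊆ hinj joins = injection-length E _ uniqE σ σ∈ σ-inj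
  where
  S : List (Fin n)
  S = endpoints E
  g : Fin q → Fin t
  g = classColouring h f d S
  σ : ∀ {x} → x ∈ E → Fin q × Fin q
  σ {(u , v)} _ = order (h u) (h v)
  σ∈ : ∀ {x} (p : x ∈ E) → σ p ∈ crossingPairs Q g
  σ∈ {(u , v)} p = order-∈crossing Q g (joins u v a h≢) (joins v u (trans (Graph.sym G v u) a) (λ e → h≢ (sym e))) g≢
    where
    a   = proj₁ (proj₂ (∈crossing⁻ (adj G) f (E⊆ p)))
    g≢ : ¬ g (h u) ≡ g (h v)
    g≢ eq = proj₂ (proj₂ (∈crossing⁻ (adj G) f (E⊆ p)))
      (trans (sym (classColouring-agrees h f d S hinj u (proj₁ (∈-endpoints E p))))
        (trans eq (classColouring-agrees h f d S hinj v (proj₂ (∈-endpoints E p)))))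
    h≢ : ¬ h u ≡ h v
    h≢ eq = g≢ (cong g eq)
  σ-inj : ∀ {x x′} (p : x ∈ E) (p′ : x′ ∈ E) → σ p ≡ σ p′ → x ≡ x′
  σ-inj {(u , v)} {(u′ , v′)} p p′ eq =
    increasing-pairs-equal (proj₁ (∈crossing⁻ (adj G) f (E⊆ p))) (proj₁ (∈crossing⁻ (adj G) f (E⊆ p′)))
      (same-vertices (order-injective (h u) (h v) (h u′) (h v′) eq))
    where
    ends : u ∈ S × v ∈ S
    ends = ∈-endpoints E p
    ends′ : u′ ∈ S × v′ ∈ S
    ends′ = ∈-endpoints E p′
    same-vertices : (h u ≡ h u′ × h v ≡ h v′) ⊎ (h u ≡ h v′ × h v ≡ h u′) →
      (u ≡ u′ × v ≡ v′) ⊎ (u ≡ v′ × v ≡ u′)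
    same-vertices (inj₁ (e₁ , e₂)) =
      inj₁ (hinj u u′ (proj₁ ends) (proj₁ ends′) e₁ , hinj v v′ (proj₂ ends) (proj₂ ends′) e₂)
    same-vertices (inj₂ (e₁ , e₂)) =
      inj₂ (hinj u v′ (proj₁ ends) (proj₂ ends′) e₁ , hinj v u′ (proj₂ ends) (proj₁ ends′) e₂)

witnessEdges : ∀ {n t} (G : Graph n) (f : Partition n t) (k : ℕ) → List (Fin n × Fin n)
witnessEdges G f k = take k (crossingPairs (adj G) f)

witnessEdges-unique : ∀ {n t} (G : Graph n) (f : Partition n t) k → Unique (witnessEdges G f k)
witnessEdges-unique G f k = take⁺ k (crossingPairs-unique (adj G) f)

witnessEdges-crossing : ∀ {n t} (G : Graph n) (f : Partition n t) k {e} →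
  e ∈ witnessEdges G f k → e ∈ crossingPairs (adj G) f
witnessEdges-crossing G f k = Sublist.lookup (take-⊆ k (crossingPairs (adj G) f))

length-witnessEdges : ∀ {n t} (G : Graph n) (f : Partition n t) k → k ≤ cutSize G f →
  length (witnessEdges G f k) ≡ k
length-witnessEdges G f k k≤cut = trans (length-take k _) (m≤n⇒m⊓n≡m k≤cut)

≤ᵇ-true⇒≤ : ∀ {m n} → (m ≤ᵇ n) ≡ true → m ≤ n
≤ᵇ-true⇒≤ {m} {n} holds = ≤ᵇ⇒≤ m n (Equivalence.from T-≡ holds)

≤⇒≤ᵇ-true : ∀ {m n} → m ≤ n → (m ≤ᵇ n) ≡ true
≤⇒≤ᵇ-true m≤n = Equivalence.to T-≡ (≤⇒≤ᵇ m≤n)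

-- Exhaustive enumeration of all maps Fin m → Fin t (up to pointwise equality).
extend : ∀ {m t} → Fin t → (Fin m → Fin t) → Fin (suc m) → Fin t
extend a g zero    = a
extend a g (suc i) = g i

allMaps : ∀ m t → List (Fin m → Fin t)
allMaps zero    t = (λ ()) ∷ []
allMaps (suc m) t = concatMap (λ a → map (extend a) (allMaps m t)) (allFin t)

allMaps-complete : ∀ m t (f : Fin m → Fin t) → ∃[ f′ ] (f′ ∈ allMaps m t × (∀ i → f′ i ≡ f i))
allMaps-complete zero    t f = (λ ()) , here refl , λ ()
allMaps-complete (suc m) t f with allMaps-complete m t (λ i → f (suc i))
... | g , g∈ , g≗ = extend (f zero) g
                  , ∈-concatMap⁺ (λ a → map (extend a) (allMaps m t))
                      (Any.map (λ { refl → ∈-map⁺ (extend (f zero)) g∈ }) (∈-allFin (f zero)))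
                  , λ { zero → refl ; (suc i) → g≗ i }

searchMap : ∀ m t → ((Fin m → Fin t) → Bool) → Maybe (Fin m → Fin t)
searchMap m t P = findᵇ P (allMaps m t)

findᵇ-sound : ∀ {A : Set} (P : A → Bool) xs {a} → findᵇ P xs ≡ just a → P a ≡ true
findᵇ-sound P (x ∷ xs) found with P x in Px
findᵇ-sound P (x ∷ xs) refl | true  = Px
...                         | false = findᵇ-sound P xs found

findᵇ-complete : ∀ {A : Set} (P : A → Bool) xs {a} → a ∈ xs → P a ≡ true → ¬ findᵇ P xs ≡ nothing
findᵇ-complete P (x ∷ xs) a∈ Pa with P x in Px
... | true = λ ()
findᵇ-complete P (x ∷ xs) (here refl) Pa | false = λ _ → ⊥-elim (false≢true (trans (sym Px) Pa))
  where false≢true : ¬ false ≡ true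
        false≢true ()
findᵇ-complete P (x ∷ xs) (there a∈) Pa | false = findᵇ-complete P xs a∈ Pa

searchMap-sound : ∀ m t P {f} → searchMap m t P ≡ just f → P f ≡ true
searchMap-sound m t P = findᵇ-sound P (allMaps m t)

searchMap-complete : ∀ m t P → (∀ f f′ → (∀ i → f i ≡ f′ i) → P f ≡ P f′) →
  ∀ f → P f ≡ true → ¬ searchMap m t P ≡ nothing
searchMap-complete m t P P-ext f Pf with allMaps-complete m t f
... | f′ , f′∈ , f′≗f = findᵇ-complete P (allMaps m t) f′∈ (trans (P-ext f′ f f′≗f) Pf)

askAll : ∀ {Q R A : Set} → List (Maybe Q) → (List (Maybe R) → DTree Q R A) → DTree Q R A
askAll []             c = c []
askAll (nothing ∷ qs) c = askAll qs (λ rs → c (nothing ∷ rs))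
askAll (just q ∷ qs)  c = query q (λ r → askAll qs (λ rs → c (just r ∷ rs)))

run-askAll : ∀ {Q R A : Set} (O : Q → R) qs (c : List (Maybe R) → DTree Q R A) →
  run O (askAll qs c) ≡ run O (c (map (Maybe.map O) qs))
run-askAll O []             c = refl
run-askAll O (nothing ∷ qs) c = run-askAll O qs _
run-askAll O (just q ∷ qs)  c = run-askAll O qs _

cost-askAll : ∀ {Q R A : Set} (O : Q → R) qs (c : List (Maybe R) → DTree Q R A) →
  cost O (askAll qs c) ≤ length qs + cost O (c (map (Maybe.map O) qs))
cost-askAll O []             c = ≤-refl
cost-askAll O (nothing ∷ qs) c = m≤n⇒m≤1+n (cost-askAll O qs _)
cost-askAll O (just q ∷ qs)  c = s≤s (cost-askAll O qs _)

mapLeaves : ∀ {Q R A B : Set} → (A → B) → DTree Q R A → DTree Q R B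
mapLeaves f (leaf a)    = leaf (f a)
mapLeaves f (query q k) = query q (λ r → mapLeaves f (k r))

run-mapLeaves : ∀ {Q R A B : Set} (O : Q → R) (f : A → B) T → run O (mapLeaves f T) ≡ f (run O T)
run-mapLeaves O f (leaf a)    = refl
run-mapLeaves O f (query q k) = run-mapLeaves O f (k (O q))

cost-mapLeaves : ∀ {Q R A B : Set} (O : Q → R) (f : A → B) T → cost O (mapLeaves f T) ≡ cost O T
cost-mapLeaves O f (leaf a)    = refl
cost-mapLeaves O f (query q k) = cong suc (cost-mapLeaves O f (k (O q)))

colourClass : ∀ {n q} → (Fin n → Fin q) → Fin q → VSet n
colourClass h i v = does (h v ≟ i)

colourClass⁻ : ∀ {n q} (h : Fin n → Fin q) i v → colourClass h i v ≡ true → h v ≡ i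
colourClass⁻ h i v inClass with h v ≟ i
colourClass⁻ h i v refl | yes hv≡i = hv≡i

colourClass⁺ : ∀ {n q} (h : Fin n → Fin q) i v → h v ≡ i → colourClass h i v ≡ true
colourClass⁺ h i v = dec-true (h v ≟ i)

classQuery : ∀ {n q} → (Fin n → Fin q) → Fin q × Fin q → Maybe (Query n)
classQuery h (i , j) with i ≟ j | any? (λ v → h v ≟ i) | any? (λ v → h v ≟ j)
... | no i≢j | yes (a , ha) | yes (b , hb) =
  just (mkQuery (colourClass h i) (colourClass h j) classesDisjoint
                (a , colourClass⁺ h i a ha) (b , colourClass⁺ h j b hb))
  where
  classesDisjoint : ∀ v → ¬ (colourClass h i v ≡ true × colourClass h j v ≡ true)
  classesDisjoint v (vi , vj) = i≢j (trans (sym (colourClass⁻ h i v vi)) (colourClass⁻ h j v vj))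
... | _ | _ | _ = nothing

classQuery-crossEdge : ∀ {n q} (G : Graph n) (h : Fin n → Fin q) i j {Q} → classQuery h (i , j) ≡ just Q →
  (∀ u v → CrossEdge G Q u v → h u ≡ i × h v ≡ j × adj G u v ≡ true) ×
  (∀ u v → h u ≡ i → h v ≡ j → adj G u v ≡ true → CrossEdge G Q u v)
classQuery-crossEdge G h i j eq with i ≟ j | any? (λ v → h v ≟ i) | any? (λ v → h v ≟ j)
classQuery-crossEdge G h i j refl | no _ | yes _ | yes _ =
  (λ u v (ui , vj , e) → colourClass⁻ h i u ui , colourClass⁻ h j v vj , e) ,
  (λ u v hu hv e → colourClass⁺ h i u hu , colourClass⁺ h j v hv , e)
classQuery-crossEdge G h i j () | yes _ | _     | _
classQuery-crossEdge G h i j () | no _  | no _  | _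
classQuery-crossEdge G h i j () | no _  | yes _ | no _

classQuery-defined : ∀ {n q} (h : Fin n → Fin q) u v → ¬ h u ≡ h v → ¬ classQuery h (h u , h v) ≡ nothing
classQuery-defined h u v h≢ with h u ≟ h v | any? (λ w → h w ≟ h u) | any? (λ w → h w ≟ h v)
... | yes h≡ | _    | _    = λ _ → h≢ h≡
... | no _  | yes _ | yes _ = λ ()
... | no _  | no ∄u | _     = λ _ → ∄u (u , refl)
... | no _  | yes _ | no ∄v = λ _ → ∄v (v , refl)

answerFor : ∀ {K B : Set} → DecidableEquality K → List K → List B → B → K → B
answerFor _≟ₖ_ []       bs       d x = d
answerFor _≟ₖ_ (k ∷ ks) []       d x = d
answerFor _≟ₖ_ (k ∷ ks) (b ∷ bs) d x with k ≟ₖ x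
... | yes _ = b
... | no  _ = answerFor _≟ₖ_ ks bs d x

answerFor-map : ∀ {K B : Set} (_≟ₖ_ : DecidableEquality K) (g : K → B) ks d x → x ∈ ks →
  answerFor _≟ₖ_ ks (map g ks) d x ≡ g x
answerFor-map _≟ₖ_ g (k ∷ ks) d x x∈ with k ≟ₖ x
... | yes k≡x = cong g k≡x
... | no  k≢x with x∈
...   | here x≡k  = ⊥-elim (k≢x (sym x≡k))
...   | there x∈′ = answerFor-map _≟ₖ_ g ks d x x∈′

Detects : ∀ {n} {R : Set} → Graph n → (R → Bool) → (Query n → R) → Set
Detects G sawEdge O = ∀ Q → (sawEdge (O Q) ≡ true → HasCrossEdge G Q) × (HasCrossEdge G Q → sawEdge (O Q) ≡ true)

module ColourCoding (n t : ℕ) {R : Set} (sawEdge : R → Bool) (k d : ℕ) where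

  q : ℕ
  q = 2 ^ d

  bitsPerRound : ℕ
  bitsPerRound = n * d

  hash : Vec Bool bitsPerRound → Fin n → Fin q
  hash s x = colour (block n d s x)

  answered : Maybe R → Bool
  answered nothing  = false
  answered (just r) = sawEdge r

  colourGraph : List (Maybe R) → Fin q → Fin q → Bool
  colourGraph as i j = answered (answerFor (Product.≡-dec _≟_ _≟_) (allPairs q) as nothing (i , j))

  bigCut : List (Maybe R) → (Fin q → Fin t) → Bool
  bigCut as g = k ≤ᵇ crossCount (colourGraph as) g

  roundResult : (Fin n → Fin q) → List (Maybe R) → Maybe (Partition n t)
  roundResult h as = Maybe.map (λ g v → g (h v)) (searchMap q t (bigCut as))

  orElse : Maybe (Partition n t) → DTree (Query n) R (Maybe (Partition n t)) → DTree (Query n) R (Maybe (Partition n t))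
  orElse (just f) _    = leaf (just f)
  orElse nothing  rest = rest

  rounds : ∀ r → Vec Bool (r * bitsPerRound) → DTree (Query n) R (Maybe (Partition n t))
  rounds zero    s = leaf nothing
  rounds (suc r) s =
    askAll (map (classQuery h) (allPairs q)) (λ as → orElse (roundResult h as) (rounds r (Vec.drop bitsPerRound s)))
    where
    h : Fin n → Fin q
    h = hash (Vec.take bitsPerRound s)

  cost-rounds : ∀ (O : Query n → R) r s → cost O (rounds r s) ≤ r * (q * q)
  cost-rounds O zero    s = z≤n
  cost-rounds O (suc r) s = ≤-trans (cost-askAll O (map (classQuery h) (allPairs q)) _)
    (+-mono-≤ (≤-reflexive (trans (length-map (classQuery h) (allPairs q)) (length-allPairs q))) (rest (roundResult h _)))
    where
    h : Fin n → Fin q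
    h = hash (Vec.take bitsPerRound s)
    rest : ∀ x → cost O (orElse x (rounds r (Vec.drop bitsPerRound s))) ≤ r * (q * q)
    rest (just f) = z≤n
    rest nothing  = cost-rounds O r (Vec.drop bitsPerRound s)

  module Correctness (G : Graph n) (O : Query n → R) (detects : Detects G sawEdge O) where

    answers : (Fin n → Fin q) → List (Maybe R)
    answers h = map (Maybe.map O) (map (classQuery h) (allPairs q))

    colourGraph-answers : ∀ h i j → colourGraph (answers h) i j ≡ answered (Maybe.map O (classQuery h (i , j)))
    colourGraph-answers h i j = cong answered (begin
      answerFor _ (allPairs q) (map (Maybe.map O) (map (classQuery h) (allPairs q))) nothing (i , j)
        ≡⟨ cong (λ as → answerFor _ (allPairs q) as nothing (i , j)) (sym (map-∘ (allPairs q))) ⟩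
      answerFor _ (allPairs q) (map (λ x → Maybe.map O (classQuery h x)) (allPairs q)) nothing (i , j)
        ≡⟨ answerFor-map _ (λ x → Maybe.map O (classQuery h x)) (allPairs q) nothing (i , j) (∈-allPairs i j) ⟩
      Maybe.map O (classQuery h (i , j)) ∎)
      where open ≡-Reasoning

    colourGraph-sound : ∀ h i j → colourGraph (answers h) i j ≡ true →
      ∃[ u ] ∃[ v ] (h u ≡ i × h v ≡ j × adj G u v ≡ true)
    colourGraph-sound h i j joined with classQuery h (i , j) in eq | colourGraph-answers h i j
    ... | just Q | answer with proj₁ (detects Q) (trans (sym answer) joined)
    ...   | u , v , cross = u , v , proj₁ (classQuery-crossEdge G h i j eq) u v cross
    colourGraph-sound h i j joined | nothing | answer = ⊥-elim (false≢true (trans (sym answer) joined))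
      where false≢true : ¬ false ≡ true
            false≢true ()

    colourGraph-complete : ∀ h u v → adj G u v ≡ true → ¬ h u ≡ h v → colourGraph (answers h) (h u) (h v) ≡ true
    colourGraph-complete h u v e h≢ with classQuery h (h u , h v) in eq | colourGraph-answers h (h u) (h v)
    ... | nothing | _      = ⊥-elim (classQuery-defined h u v h≢ eq)
    ... | just Q  | answer =
      trans answer (proj₂ (detects Q) (u , v , proj₂ (classQuery-crossEdge G h (h u) (h v) eq) u v refl refl e))

    rounds-sound : ∀ r s f → run O (rounds r s) ≡ just f → k ≤ cutSize G f
    rounds-sound (suc r) s f out = after-round (searchMap q t (bigCut as)) refl
      (trans (sym (run-askAll O (map (classQuery h) (allPairs q)) _)) out)
      where
      h : Fin n → Fin q
      h = hash (Vec.take bitsPerRound s)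
      as : List (Maybe R)
      as = answers h
      after-round : ∀ x → searchMap q t (bigCut as) ≡ x →
        run O (orElse (Maybe.map (λ g v → g (h v)) x) (rounds r (Vec.drop bitsPerRound s))) ≡ just f → k ≤ cutSize G f
      after-round nothing  _     out′ = rounds-sound r (Vec.drop bitsPerRound s) f out′
      after-round (just g) found refl = ≤-trans
        (≤ᵇ-true⇒≤ (searchMap-sound q t (bigCut as) found))
        (lift-cut G h (colourGraph as) g (colourGraph-sound h))

    -- Fix a cut f of size ≥ k; a round succeeds unless its labelling merges two
    -- endpoints of the first k crossing edges of f.
    module GivenCut (d₀ : Fin t) (f : Partition n t) (bigF : k ≤ cutSize G f) where

      E : List (Fin n × Fin n)
      E = witnessEdges G f k

      S : List (Fin n)
      S = endpoints E

      collapses : Vec Bool bitsPerRound → Bool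
      collapses = merges n d (cartesianProduct S S)

      round-succeeds : ∀ s → collapses s ≡ false → ¬ searchMap q t (bigCut (answers (hash s))) ≡ nothing
      round-succeeds s noCollapse =
        searchMap-complete q t (bigCut as) bigCut-ext (classColouring h f d₀ S) found
        where
        h : Fin n → Fin q
        h = hash s
        as : List (Maybe R)
        as = answers h
        bigCut-ext : ∀ g g′ → (∀ i → g i ≡ g′ i) → bigCut as g ≡ bigCut as g′
        bigCut-ext g g′ g≗g′ = cong (λ c → k ≤ᵇ c) (crossCount-cong (colourGraph as) g g′ g≗g′)
        injective : InjectiveOn h S
        injective x y x∈ y∈ hx≡hy = unmerged n d (cartesianProduct S S) s x y noCollapse
          (∈-cartesianProduct⁺ x∈ y∈) (colour-injective _ _ hx≡hy)
        cut : k ≤ crossCount (colourGraph as) (classColouring h f d₀ S)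
        cut = subst (_≤ crossCount (colourGraph as) (classColouring h f d₀ S)) (length-witnessEdges G f k bigF)
          (transfer-cut G h (colourGraph as) f d₀ E (witnessEdges-unique G f k) (witnessEdges-crossing G f k)
            injective (colourGraph-complete h))
        found : bigCut as (classColouring h f d₀ S) ≡ true
        found = ≤⇒≤ᵇ-true cut

      allCollapse : ∀ r → Vec Bool (r * bitsPerRound) → Bool
      allCollapse r = allRoundsFail r bitsPerRound collapses

      rounds-complete : ∀ r s → allCollapse r s ≡ false → ¬ run O (rounds r s) ≡ nothing
      rounds-complete (suc r) s notAll out = after-round (searchMap q t (bigCut as)) refl
        (trans (sym (run-askAll O (map (classQuery h) (allPairs q)) _)) out)
        where
        h : Fin n → Fin q
        h = hash (Vec.take bitsPerRound s)
        as : List (Maybe R)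
        as = answers h
        after-round : ∀ x → searchMap q t (bigCut as) ≡ x →
          ¬ run O (orElse (Maybe.map (λ g v → g (h v)) x) (rounds r (Vec.drop bitsPerRound s))) ≡ nothing
        after-round (just g) _ ()
        after-round nothing none out′ with collapses (Vec.take bitsPerRound s) in c
        ... | false = round-succeeds (Vec.take bitsPerRound s) c none
        ... | true  = rounds-complete r (Vec.drop bitsPerRound s) notAll out′

⌊log₂⌋-halve : ∀ n → ⌊log₂ (2 + n) ⌋ ≡ suc ⌊log₂ (suc ⌊ n /2⌋) ⌋
⌊log₂⌋-halve n = sym (begin
  suc ⌊log₂ (suc ⌊ n /2⌋) ⌋ ≡⟨ cong suc (⌊log₂⌊n/2⌋⌋≡⌊log₂n⌋∸1 (2 + n)) ⟩
  suc (L ∸ 1)               ≡⟨ +-comm 1 (L ∸ 1) ⟩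
  (L ∸ 1) + 1               ≡⟨ m∸n+n≡m 1≤L ⟩
  L                         ∎)
  where
  open ≡-Reasoning
  L : ℕ
  L = ⌊log₂ (2 + n) ⌋
  1≤L : 1 ≤ L
  1≤L = subst (_≤ L) (⌊log₂[2^n]⌋≡n 1) (⌊log₂⌋-mono-≤ {2} {2 + n} (s≤s (s≤s z≤n)))

twice-half : ∀ n → 2 * ⌊ n /2⌋ ≤ n
twice-half n = begin
  2 * ⌊ n /2⌋       ≡⟨ cong (⌊ n /2⌋ +_) (+-identityʳ ⌊ n /2⌋) ⟩
  ⌊ n /2⌋ + ⌊ n /2⌋ ≤⟨ +-monoʳ-≤ ⌊ n /2⌋ (⌊n/2⌋≤⌈n/2⌉ n) ⟩
  ⌊ n /2⌋ + ⌈ n /2⌉ ≡⟨ ⌊n/2⌋+⌈n/2⌉≡n n ⟩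
  n                 ∎
  where open ≤-Reasoning

2^⌊log₂⌋≤ : ∀ k → 1 ≤ k → 2 ^ ⌊log₂ k ⌋ ≤ k
2^⌊log₂⌋≤ = <-rec (λ k → 1 ≤ k → 2 ^ ⌊log₂ k ⌋ ≤ k) step
  where
  step : ∀ k → (∀ {j} → j < k → 1 ≤ j → 2 ^ ⌊log₂ j ⌋ ≤ j) → 1 ≤ k → 2 ^ ⌊log₂ k ⌋ ≤ k
  step (suc zero)    rec _ = ≤-refl
  step (suc (suc n)) rec _ = begin
    2 ^ ⌊log₂ (2 + n) ⌋              ≡⟨ cong (2 ^_) (⌊log₂⌋-halve n) ⟩
    2 * 2 ^ ⌊log₂ (suc ⌊ n /2⌋) ⌋    ≤⟨ *-monoʳ-≤ 2 (rec (s≤s (s≤s (⌊n/2⌋≤n n))) (s≤s z≤n)) ⟩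
    2 * suc ⌊ n /2⌋                  ≡⟨ *-suc 2 ⌊ n /2⌋ ⟩
    2 + 2 * ⌊ n /2⌋                  ≤⟨ +-monoʳ-≤ 2 (twice-half n) ⟩
    2 + n                            ∎
    where open ≤-Reasoning

-- The upper bound k < 2^(1 + ⌊log₂ k⌋), since ⌊log₂⌋ is monotone and ⌊log₂ 2^m⌋ = m.
<2^suc⌊log₂⌋ : ∀ k → k < 2 ^ suc ⌊log₂ k ⌋
<2^suc⌊log₂⌋ k with k <? 2 ^ suc ⌊log₂ k ⌋
... | yes k< = k<
... | no  k≮ = ⊥-elim (<-irrefl refl (begin-strict
  ⌊log₂ k ⌋                          <⟨ n<1+n _ ⟩
  suc ⌊log₂ k ⌋                      ≡⟨ sym (⌊log₂[2^n]⌋≡n (suc ⌊log₂ k ⌋)) ⟩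
  ⌊log₂ (2 ^ suc ⌊log₂ k ⌋) ⌋        ≤⟨ ⌊log₂⌋-mono-≤ (≮⇒≥ k≮) ⟩
  ⌊log₂ k ⌋                          ∎))
  where open ≤-Reasoning

-- Parameters for a target cut size k: 1 + ⌊log₂ k⌋ rounds and d = 5 + 2⌊log₂ k⌋
-- label bits, so that 8k² ≤ 2^d ≤ 32k² and k ≤ 2^rounds.
roundsFor : ℕ → ℕ
roundsFor k = suc ⌊log₂ k ⌋

labelBits : ℕ → ℕ
labelBits k = 5 + (⌊log₂ k ⌋ + ⌊log₂ k ⌋)

2^labelBits : ∀ k → 2 ^ labelBits k ≡ 32 * (2 ^ ⌊log₂ k ⌋ * 2 ^ ⌊log₂ k ⌋)
2^labelBits k = trans (^-distribˡ-+-* 2 5 (⌊log₂ k ⌋ + ⌊log₂ k ⌋))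
                      (cong (32 *_) (^-distribˡ-+-* 2 ⌊log₂ k ⌋ ⌊log₂ k ⌋))

query-count : ∀ k → 1 ≤ k → roundsFor k * (2 ^ labelBits k * 2 ^ labelBits k) ≤ queryBound 1024 k
query-count k 1≤k = begin
  roundsFor k * (q * q)                  ≡⟨ *-comm (roundsFor k) (q * q) ⟩
  (q * q) * roundsFor k                  ≡⟨ cong (λ x → x * x * roundsFor k) (2^labelBits k) ⟩
  (32 * (a * a)) * (32 * (a * a)) * roundsFor k ≡⟨ cong (_* roundsFor k) (square a) ⟩
  1024 * a ^ 4 * roundsFor k
    ≤⟨ *-monoˡ-≤ (roundsFor k) (*-monoʳ-≤ 1024 (^-monoˡ-≤ 4 (2^⌊log₂⌋≤ k 1≤k))) ⟩
  1024 * k ^ 4 * roundsFor k             ∎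
  where
  open ≤-Reasoning
  q a : ℕ
  q = 2 ^ labelBits k
  a = 2 ^ ⌊log₂ k ⌋
  square : ∀ x → (32 * (x * x)) * (32 * (x * x)) ≡ 1024 * (x * (x * (x * (x * 1))))
  square = solve-∀

-- Since 2^d ≥ 8k², a round that fails with probability ≤ (2k)² · 2^-d fails w.p. ≤ 1/2.
failure-half : ∀ k M c → c * 2 ^ labelBits k ≤ (2 * k) * (2 * k) * M → 2 * c ≤ M
failure-half k M c bound = *-cancelʳ-≤ (2 * c) M (2 ^ labelBits k) {{m^n≢0 2 (labelBits k)}} (begin
  (2 * c) * 2 ^ labelBits k     ≡⟨ *-assoc 2 c _ ⟩
  2 * (c * 2 ^ labelBits k)     ≤⟨ *-monoʳ-≤ 2 bound ⟩
  2 * ((2 * k) * (2 * k) * M)   ≡⟨ rearrange k M ⟩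
  (8 * (k * k)) * M             ≤⟨ *-monoˡ-≤ M 8k²≤2^d ⟩
  2 ^ labelBits k * M           ≡⟨ *-comm (2 ^ labelBits k) M ⟩
  M * 2 ^ labelBits k           ∎)
  where
  open ≤-Reasoning
  a : ℕ
  a = 2 ^ ⌊log₂ k ⌋
  rearrange : ∀ x y → 2 * ((2 * x) * (2 * x) * y) ≡ (8 * (x * x)) * y
  rearrange = solve-∀
  k≤2a : k ≤ 2 * a
  k≤2a = <⇒≤ (<2^suc⌊log₂⌋ k)
  8k²≤2^d : 8 * (k * k) ≤ 2 ^ labelBits k
  8k²≤2^d = begin
    8 * (k * k)             ≤⟨ *-monoʳ-≤ 8 (*-mono-≤ k≤2a k≤2a) ⟩
    8 * ((2 * a) * (2 * a)) ≡⟨ rearrange′ a ⟩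
    32 * (a * a)            ≡⟨ sym (2^labelBits k) ⟩
    2 ^ labelBits k         ∎
    where
    rearrange′ : ∀ x → 8 * ((2 * x) * (2 * x)) ≡ 32 * (x * x)
    rearrange′ = solve-∀

isBigCut : ∀ {n} (G : Graph n) t k → Partition n t → Bool
isBigCut G t k f = k ≤ᵇ cutSize G f

cutExists? : ∀ {n} (G : Graph n) t k → Dec (CutExists G t k)
cutExists? {n} G t k with searchMap n t (isBigCut G t k) in found
... | just f  = yes (f , ≤ᵇ-true⇒≤ (searchMap-sound n t (isBigCut G t k) found))
... | nothing = no λ (f , k≤cut) → searchMap-complete n t (isBigCut G t k)
  (λ f f′ f≗f′ → cong (k ≤ᵇ_) (crossCount-cong (adj G) f f′ f≗f′)) f (≤⇒≤ᵇ-true k≤cut) found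

decision-from-cut : ∀ {n} (G : Graph n) t k out → CutCorrect G t k out → DecisionCutCorrect G t k (is-just out)
decision-from-cut G t k (just f) (sound , _)    = (λ _ → f , sound f refl) , (λ _ → refl)
decision-from-cut G t k nothing  (_ , complete) = (λ ()) , (λ cut → ⊥-elim (complete refl cut))

bise-detects : ∀ {n} (G : Graph n) (O : Query n → Maybe (Fin n × Fin n)) → IsBISE G O → Detects G is-just O
bise-detects G O bise Q with O Q in answer
... | just (u , v) = (λ _ → u , v , proj₁ (bise Q) u v answer) , (λ _ → refl)
... | nothing      = (λ ()) , (λ cross → ⊥-elim (proj₂ (bise Q) answer cross))

success-mono : ∀ {a b k r} {Good Good′ : Vec Bool r → Set} → (∀ s → Good s → Good′ s) →
  SuccessAtLeast a b k r Good → SuccessAtLeast a b k r Good′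
success-mono good⇒ (L , good , bound) = L , (λ s s∉L → good⇒ s (good s s∉L)) , bound

success-1/k : ∀ k {r} {Good : Vec Bool r → Set} (L : List (Vec Bool r)) →
  (∀ s → s ∉ L → Good s) → length L * k ≤ 2 ^ r → SuccessAtLeast 1 1 k r Good
success-1/k k {r} L good bound = L , good ,
  subst₂ _≤_ (sym (cong₂ _*_ (*-identityʳ (length L)) (*-identityʳ k))) (cong (2 ^_) (sym (*-identityʳ r))) bound

module Algorithm (n t : ℕ) {R : Set} (sawEdge : R → Bool) (k : ℕ) where
  open ColourCoding n t sawEdge k (labelBits k) public

  seedBits : ℕ
  seedBits = roundsFor k * bitsPerRound

  findCut : Vec Bool seedBits → DTree (Query n) R (Maybe (Partition n t))
  findCut = rounds (roundsFor k)

  findCut-cost : 1 ≤ k → ∀ (O : Query n → R) s → cost O (findCut s) ≤ queryBound 1024 k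
  findCut-cost 1≤k O s = ≤-trans (cost-rounds O (roundsFor k) s) (query-count k 1≤k)

  module _ (G : Graph n) (O : Query n → R) (detects : Detects G sawEdge O) where
    open Correctness G O detects

    module _ (d₀ : Fin t) (f : Partition n t) (bigF : k ≤ cutSize G f) where
      open GivenCut d₀ f bigF

      badSeeds : List (Vec Bool seedBits)
      badSeeds = seedsWith seedBits (allCollapse (roundsFor k))

      good-outside-badSeeds : ∀ s → s ∉ badSeeds → CutCorrect G t k (run O (findCut s))
      good-outside-badSeeds s s∉ = by-outcome (allCollapse (roundsFor k) s) refl
        where
        by-outcome : ∀ b → allCollapse (roundsFor k) s ≡ b → CutCorrect G t k (run O (findCut s))
        by-outcome true  bad  = ⊥-elim (s∉ (∈-seedsWith seedBits (allCollapse (roundsFor k)) s bad))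
        by-outcome false good = rounds-sound (roundsFor k) s , λ none _ → rounds-complete (roundsFor k) s good none

      -- one round collapses with probability ≤ 1/2, so all rounds do with probability ≤ 1/k
      badSeeds-bound : length badSeeds * k ≤ 2 ^ seedBits
      badSeeds-bound = begin
        length badSeeds * k                 ≡⟨ cong (_* k) (length-seedsWith seedBits (allCollapse (roundsFor k))) ⟩
        count seedBits (allCollapse (roundsFor k)) * k
          ≡⟨ cong (_* k) (count-allRoundsFail (roundsFor k) bitsPerRound collapses) ⟩
        c ^ roundsFor k * k                 ≤⟨ *-monoʳ-≤ (c ^ roundsFor k) (<⇒≤ (<2^suc⌊log₂⌋ k)) ⟩
        c ^ roundsFor k * 2 ^ roundsFor k   ≡⟨ *-comm (c ^ roundsFor k) _ ⟩
        2 ^ roundsFor k * c ^ roundsFor k   ≤⟨ amplify (roundsFor k) bitsPerRound c (failure-half k _ c round-bound) ⟩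
        2 ^ seedBits                        ∎
        where
        open ≤-Reasoning
        c : ℕ
        c = count bitsPerRound collapses
        |S| : length S ≡ 2 * k
        |S| = trans (length-endpoints E) (cong (2 *_) (length-witnessEdges G f k bigF))
        round-bound : c * 2 ^ labelBits k ≤ (2 * k) * (2 * k) * 2 ^ bitsPerRound
        round-bound = subst (λ z → c * 2 ^ labelBits k ≤ z * 2 ^ bitsPerRound)
          (trans (length-cartesianProduct S S) (cong₂ _*_ |S| |S|))
          (merges-bound n (labelBits k) (cartesianProduct S S))

    succeeds-given : Fin t → Dec (CutExists G t k) →
      SuccessAtLeast 1 1 k seedBits (λ s → CutCorrect G t k (run O (findCut s)))
    succeeds-given d₀ (no ∄cut) = success-1/k k [] (λ s _ → rounds-sound (roundsFor k) s , λ _ → ∄cut) z≤n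
    succeeds-given d₀ (yes (f , bigF)) =
      success-1/k k (badSeeds d₀ f bigF) (good-outside-badSeeds d₀ f bigF) (badSeeds-bound d₀ f bigF)

    findCut-succeeds : Fin t → SuccessAtLeast 1 1 k seedBits (λ s → CutCorrect G t k (run O (findCut s)))
    findCut-succeeds d₀ = succeeds-given d₀ (cutExists? G t k)

decisionAlg : (n t k : ℕ) → RandAlg (Query n) Bool Bool
decisionAlg n t k = record { seedLen = seedBits ; tree = λ s → mapLeaves is-just (findCut s) }
  where open Algorithm n t (λ b → b) k

decisionAlg-correct : (n t k : ℕ) → 1 ≤ t → 1 ≤ k → (G : Graph n) (O : Query n → Bool) → IsBIS G O →
  let A = decisionAlg n t k in
  ((s : Vec Bool (seedLen A)) → cost O (tree A s) ≤ queryBound 1024 k)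
  × SuccessAtLeast 1 1 k (seedLen A) (λ s → DecisionCutCorrect G t k (run O (tree A s)))
decisionAlg-correct n (suc t) k _ 1≤k G O bis =
  (λ s → subst (_≤ queryBound 1024 k) (sym (cost-mapLeaves O is-just (findCut s))) (findCut-cost 1≤k O s)) ,
  success-mono {1} {1} {k} {seedBits} (λ s correct → subst (DecisionCutCorrect G (suc t) k) (sym (run-mapLeaves O is-just (findCut s)))
                                                        (decision-from-cut G (suc t) k _ correct))
               (findCut-succeeds G O bis zero)
  where open Algorithm n (suc t) (λ b → b) k

cutAlg : (n t k : ℕ) → RandAlg (Query n) (Maybe (Fin n × Fin n)) (Maybe (Partition n t))
cutAlg n t k = record { seedLen = seedBits ; tree = findCut }
  where open Algorithm n t is-just k

cutAlg-correct : (n t k : ℕ) → 1 ≤ t → 1 ≤ k →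
  (G : Graph n) (O : Query n → Maybe (Fin n × Fin n)) → IsBISE G O →
  let A = cutAlg n t k in
  ((s : Vec Bool (seedLen A)) → cost O (tree A s) ≤ queryBound 1024 k)
  × SuccessAtLeast 1 1 k (seedLen A) (λ s → CutCorrect G t k (run O (tree A s)))
cutAlg-correct n (suc t) k _ 1≤k G O bise =
  findCut-cost 1≤k O , findCut-succeeds G O (bise-detects G O bise) zero
  where open Algorithm n (suc t) is-just k

theorem8 : (∃[ C ] ∃[ a ] ∃[ b ] (1 ≤ a × 1 ≤ b ×
    Σ[ alg ∈ ((n t k : ℕ) → RandAlg (Query n) Bool Bool) ] ((n t k : ℕ) → 1 ≤ t → 1 ≤ k →
    (G : Graph n) (O : Query n → Bool) → IsBIS G O →
    let A = alg n t k in
    ((s : Vec Bool (seedLen A)) → cost O (tree A s) ≤ queryBound C k)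
    × SuccessAtLeast a b k (seedLen A)
    (λ s → DecisionCutCorrect G t k (run O (tree A s))))))
    × (∃[ C ] ∃[ a ] ∃[ b ] (1 ≤ a × 1 ≤ b ×
    Σ[ alg ∈ ((n t k : ℕ) → RandAlg (Query n) (Maybe (Fin n × Fin n)) (Maybe (Partition n t))) ] ((n t k : ℕ) → 1 ≤ t → 1 ≤ k →
    (G : Graph n) (O : Query n → Maybe (Fin n × Fin n)) → IsBISE G O →
    let A = alg n t k in
    ((s : Vec Bool (seedLen A)) → cost O (tree A s) ≤ queryBound C k)
    × SuccessAtLeast a b k (seedLen A)
    (λ s → CutCorrect G t k (run O (tree A s))))))
theorem8 = (1024 , 1 , 1 , ≤-refl , ≤-refl , decisionAlg , decisionAlg-correct)
         , (1024 , 1 , 1 , ≤-refl , ≤-refl , cutAlg , cutAlg-correct)
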